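{- Let $k,n,t$ be integers with $k\geq 0$, $n\geq 1$ and $t\in\{0,1\}$. If $n\equiv 2\pmod 4$, then there exists a $(3\cdot n;k;1)$-Skolem system which admits an $R'$-order.
   Context: $[a,b]$ denotes $\{a,a+1,\ldots,b\}$. Let $m_1,\ldots,m_n\geq 3$ be integers, $M=\sum_i m_i$, $k\geq 0$ an integer and $t\in\{0,1\}$. An $(m_1,\ldots,m_n;k;t)$-Skolem system (of order $n$ and size $M$) is a family $S=\{D_1,\ldots,D_n\}$ of sequences of integers such that $|D_i|=m_i$, the entries of each $D_i$ sum to $0$, and, writing $abs(D_i)$ for the set of absolute values of the entries of $D_i$, the sets $abs(D_1),\ldots,abs(D_n)$ form a partition of $[1,r]\cup[r+1+k,M+k-1]\cup\{M+k+t\}$ for some positive integer $r$. A $(3\cdot n;k;t)$-Skolem system is one with $m_1=\cdots=m_n=3$ (so $M=3n$). An ordering $(D_1,\ldots,D_n)$ of a $(3\cdot n;k;t)$-Skolem system is an $R$-order if (i) for every $1\leq i\leq n-1$ there exist $d\in abs(D_i)$ and $d'\in abs(D_{i+1})$ with $|d-d'|=1$, and (ii) $3n+k+t\in abs(D_n)$. An $R$-order is an $R'$-order if moreover (iii) for some odd $q$ there exist $d\in abs(D_q)$ and $d'\in abs(D_{q+1})$ with $|d-d'|=2$. -}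

module Defs where

open import Data.Nat using (ℕ; suc; _+_; _*_; _∸_; _≤_; ∣_-_∣)
open import Data.Integer as ℤ using (ℤ; ∣_∣)
open import Data.Fin using (Fin; toℕ)
open import Data.Product using (_×_; ∃; Σ; _,_)
open import Data.Sum using (_⊎_)
open import Relation.Binary.PropositionalEquality using (_≡_; _≢_)
open import Relation.Nullary using (¬_)
open import Function.Bundles using (_⇔_)

Triple : Set
Triple = ℤ × ℤ × ℤ

tsum : Triple → ℤ
tsum (a , b , c) = a ℤ.+ (b ℤ.+ c)

_∈abs_ : ℕ → Triple → Set
d ∈abs (a , b , c) = d ≡ ∣ a ∣ ⊎ d ≡ ∣ b ∣ ⊎ d ≡ ∣ c ∣

InTarget : (M k t r d : ℕ) → Set
InTarget M k t r d =
  (1 ≤ d × d ≤ r) ⊎ (r + 1 + k ≤ d × d ≤ M + k ∸ 1) ⊎ d ≡ M + k + t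

-- (3·n;k;t)-Skolem system, given as an indexed family D_0,…,D_{n-1}
-- (index i : Fin n stands for D_{i+1}; the indexing is also the ordering).
IsSkolem3 : (n k t : ℕ) → (Fin n → Triple) → Set
IsSkolem3 n k t D =
  (∀ i → tsum (D i) ≡ ℤ.0ℤ) ×
  Σ ℕ λ r → 1 ≤ r ×
    (∀ i j d → i ≢ j → d ∈abs D i → ¬ (d ∈abs D j)) ×
    (∀ d → InTarget (3 * n) k t r d ⇔ ∃ λ i → d ∈abs D i)

Close : ℕ → Triple → Triple → Set
Close δ D D' = ∃ λ d → ∃ λ d' → d ∈abs D × d' ∈abs D' × ∣ d - d' ∣ ≡ δ

IsROrder : (n k t : ℕ) → (Fin n → Triple) → Set
IsROrder n k t D =
  (∀ i j → toℕ j ≡ suc (toℕ i) → Close 1 (D i) (D j)) ×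
  (∃ λ i → suc (toℕ i) ≡ n × (3 * n + k + t) ∈abs D i)

-- (D_1,…,D_n) is an R'-order: R-order, and for some odd q (q = toℕ i + 1,
-- i.e. toℕ i even) D_q and D_{q+1} contain values at distance 2.
Even : ℕ → Set
Even m = ∃ λ h → m ≡ h + h

IsR'Order : (n k t : ℕ) → (Fin n → Triple) → Set
IsR'Order n k t D =
  IsROrder n k t D ×
  (∃ λ i → ∃ λ j → toℕ j ≡ suc (toℕ i) × Even (toℕ i) × Close 2 (D i) (D j))

-- A hooked Skolem sequence of order n gives each d ∈ [1, n] two positions p_d and p_d + d so that these
-- positions are exactly 0, …, 2n − 2 and 2n. With L = n + k + 1, the triples (d, L + p_d, −(L + p_d + d))
-- sum to zero and their absolute values partition [1, n] ∪ [n + k + 1, 3n + k − 1] ∪ {3n + k + 1}: they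
-- form a (3·n; k; 1)-Skolem system with r = n. Hooked Skolem sequences of order n ≡ 2 (mod 4) exist; we
-- write one down for n = 4t + 6 and for n = 2. Listed by increasing d, consecutive triples have small
-- entries at distance 1, and the triple of d = n, which owns the hook 2n, comes last. Swapping the labels
-- c + 1 and c + 2 (c = 1 or 3) makes the triples of c and c + 2 neighbours at the odd place c, at distance
-- 2; the two new neighbour pairs (c, c + 2) and (c + 1, c + 3) stay at distance 1 because the sequence has
-- adjacent positions for them.

module Submission where

open import Data.Empty using (⊥-elim)
open import Data.Fin using (Fin; toℕ; fromℕ<)
open import Data.Fin.Patterns using (0F; 1F)
open import Data.Fin.Properties using (toℕ-injective; toℕ<n; toℕ-fromℕ<)
open import Data.Integer as ℤ using (+_)
import Data.Integer.Tactic.RingSolver as ℤ-Solver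
open import Data.List using (List; []; _∷_)
open import Data.Nat using (ℕ; zero; suc; _+_; _*_; _∸_; _≤_; _<_; _%_; _/_; z≤n; s≤s; ∣_-_∣; _≟_; _<?_)
open import Data.Nat.DivMod using (m≡m%n+[m/n]*n)
open import Data.Nat.Properties
open import Data.Nat.Tactic.RingSolver using (solve)
open import Data.Product using (Σ; _×_; _,_; ∃; ∃₂; proj₁; proj₂)
open import Data.Sum using (_⊎_; inj₁; inj₂; [_,_]′)
open import Function.Base using (_∘_)
open import Function.Bundles using (mk⇔)
open import Relation.Binary.PropositionalEquality
open import Relation.Nullary using (¬_; yes; no)
open import Defs

m+n≡o⇒m≤o : ∀ {m o} n → m + n ≡ o → m ≤ o
m+n≡o⇒m≤o {m} n refl = m≤m+n m n

-- m and o are explicit: unification cannot recover them from o ∸ m.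
m+n≡o⇒o∸m≡n : ∀ m o {n} → m + n ≡ o → o ∸ m ≡ n
m+n≡o⇒o∸m≡n m _ {n} refl = m+n∸m≡n m n

≡-via : ∀ {a b l r} (f : ℕ → ℕ) → a ≡ b → l ≡ f a → f b ≡ r → l ≡ r
≡-via f refl l≡fa fb≡r = trans l≡fa fb≡r

∣n-k+n∣≡k : ∀ k n → ∣ n - k + n ∣ ≡ k
∣n-k+n∣≡k k n = trans (cong (λ m → ∣ n - m ∣) (+-comm k n)) (∣m-m+n∣≡n n k)

∣1+n-n∣≡1 : ∀ n → ∣ suc n - n ∣ ≡ 1
∣1+n-n∣≡1 n = trans (∣-∣-comm (suc n) n) (∣n-k+n∣≡k 1 n)

double-≤⇒≤ : ∀ {a b} → a + a ≤ b + b → a ≤ b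
double-≤⇒≤ a+a≤b+b = ≮⇒≥ λ b<a → <⇒≱ (+-mono-< b<a b<a) a+a≤b+b

double-<⇒< : ∀ {a b} → a + a < b + b → a < b
double-<⇒< a+a<b+b = ≰⇒> λ b≤a → <⇒≱ a+a<b+b (+-mono-≤ b≤a b≤a)

-- The equation comes last so that both its sides are known when it is elaborated: the ring solver needs a
-- goal without metavariables.
cast : ∀ (P : ℕ → Set) {x y} → P y → x ≡ y → P x
cast P py refl = py

-- Skolem systems from hooked Skolem sequences

data Slot (n : ℕ) : ℕ → Set where
  inner : ∀ {p} → suc p < n + n → Slot n p
  hook  : Slot n (n + n)

module _ (n : ℕ) (first : ℕ → ℕ) where

  IsPosition : ℕ → ℕ → Set
  IsPosition d p = first d ≡ p ⊎ first d + d ≡ p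

  Placed : (owner : ℕ → ℕ) → ℕ → Set
  Placed owner d = (Slot n (first d) × owner (first d) ≡ d) × (Slot n (first d + d) × owner (first d + d) ≡ d)

  Covered : ℕ → Set
  Covered p = ∃ λ d → 1 ≤ d × d ≤ n × IsPosition d p

  Adjacent : ℕ → ℕ → Set
  Adjacent d e = ∃₂ λ p q → IsPosition d p × IsPosition e q × ∣ p - q ∣ ≡ 1

-- owner inverts d ↦ {first d, first d + d}, which makes the positions of distinct labels distinct.
record IsHookedSkolem (n : ℕ) (first owner : ℕ → ℕ) : Set where
  field
    placed  : ∀ d → 1 ≤ d → d ≤ n → Placed n first owner d
    covered : ∀ p → Slot n p → Covered n first p

record Labelling (n : ℕ) : Set where
  field
    label           : Fin n → ℕ
    label-injective : ∀ {i j} → label i ≡ label j → i ≡ j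
    1≤label         : ∀ i → 1 ≤ label i
    label≤n         : ∀ i → label i ≤ n
    label-onto      : ∀ d → 1 ≤ d → d ≤ n → ∃ λ i → label i ≡ d

R'OrderedSkolem : ℕ → ℕ → Set
R'OrderedSkolem n k = Σ (Fin n → Triple) λ D → IsSkolem3 n k 1 D × IsR'Order n k 1 D

module SkolemSystem {n first owner} (hooked : IsHookedSkolem n first owner)
                    (L : Labelling n) (k : ℕ) where
  open IsHookedSkolem hooked
  open Labelling L public

  -- n + k + 1 + p, with suc outermost so that ∣ ℤ.- + large p ∣ reduces to large p.
  large : ℕ → ℕ
  large p = suc (n + k + p)

  block : ℕ → Triple
  block d = + d , + large (first d) , ℤ.- (+ large (first d + d))

  system : Fin n → Triple
  system i = block (label i)

  large-shift : ∀ p d → large (p + d) ≡ d + large p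
  large-shift p d = begin
    suc (n + k + (p + d)) ≡⟨ solve (n ∷ k ∷ p ∷ d ∷ []) ⟩
    d + suc (n + k + p)   ∎
    where open ≡-Reasoning

  block-sum : ∀ d → tsum (block d) ≡ ℤ.0ℤ
  block-sum d = begin
    + d ℤ.+ (+ large f ℤ.+ ℤ.- + large (f + d))
      ≡⟨ cong (λ z → + d ℤ.+ (+ large f ℤ.+ ℤ.- + z)) (large-shift f d) ⟩
    + d ℤ.+ (+ large f ℤ.+ ℤ.- (+ d ℤ.+ + large f))
      ≡⟨ cancel (+ d) (+ large f) ⟩
    ℤ.0ℤ ∎
    where
    open ≡-Reasoning
    f = first d
    cancel : ∀ a b → a ℤ.+ (b ℤ.+ ℤ.- (a ℤ.+ b)) ≡ ℤ.0ℤ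
    cancel = ℤ-Solver.solve-∀

  owned : ∀ {d p} → 1 ≤ d → d ≤ n → IsPosition n first d p → Slot n p × owner p ≡ d
  owned 1≤d d≤n (inj₁ refl) = proj₁ (placed _ 1≤d d≤n)
  owned 1≤d d≤n (inj₂ refl) = proj₂ (placed _ 1≤d d≤n)

  1≤n : 1 ≤ n
  1≤n with covered (n + n) hook
  ... | _ , 1≤d , d≤n , _ = ≤-trans 1≤d d≤n

  n<large : ∀ p → n < large p
  n<large p = s≤s (≤-trans (m≤m+n n k) (m≤m+n (n + k) p))

  large-hook : large (n + n) ≡ 3 * n + k + 1
  large-hook = begin
    suc (n + k + (n + n)) ≡⟨ solve (n ∷ k ∷ []) ⟩
    3 * n + k + 1         ∎
    where open ≡-Reasoning

  ∈block : ∀ {x d} → x ∈abs block d → x ≡ d ⊎ ∃ λ p → IsPosition n first d p × x ≡ large p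
  ∈block (inj₁ x≡d)          = inj₁ x≡d
  ∈block (inj₂ (inj₁ x≡p))   = inj₂ (_ , inj₁ refl , x≡p)
  ∈block (inj₂ (inj₂ x≡p))   = inj₂ (_ , inj₂ refl , x≡p)

  large∈block : ∀ {d p} → IsPosition n first d p → large p ∈abs block d
  large∈block (inj₁ refl) = inj₂ (inj₁ refl)
  large∈block (inj₂ refl) = inj₂ (inj₂ refl)

  disjoint : ∀ i j x → i ≢ j → x ∈abs system i → ¬ (x ∈abs system j)
  disjoint i j x i≢j x∈i x∈j with ∈block x∈i | ∈block x∈j
  ... | inj₁ refl | inj₁ e = i≢j (label-injective e)
  ... | inj₁ refl | inj₂ (p , _ , e) = <⇒≢ (≤-<-trans (label≤n i) (n<large p)) e
  ... | inj₂ (p , _ , e) | inj₁ refl = <⇒≢ (≤-<-trans (label≤n j) (n<large p)) e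
  ... | inj₂ (p , pos , refl) | inj₂ (q , pos′ , e) = i≢j (label-injective (begin
    label i ≡⟨ proj₂ (owned (1≤label i) (label≤n i) pos) ⟨
    owner p ≡⟨ cong owner (+-cancelˡ-≡ (n + k) p q (suc-injective e)) ⟩
    owner q ≡⟨ proj₂ (owned (1≤label j) (label≤n j) pos′) ⟩
    label j ∎))
    where open ≡-Reasoning

  large-covered : ∀ p → Slot n p → ∃ λ i → large p ∈abs system i
  large-covered p s with covered p s
  ... | d , 1≤d , d≤n , pos with label-onto d 1≤d d≤n
  ...   | i , refl = i , large∈block pos

  toTarget : ∀ x i → x ∈abs system i → InTarget (3 * n) k 1 n x
  toTarget x i x∈i with ∈block x∈i
  ... | inj₁ refl = inj₁ (1≤label i , label≤n i)
  ... | inj₂ (p , pos , refl) with proj₁ (owned (1≤label i) (label≤n i) pos)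
  ...   | hook       = inj₂ (inj₂ large-hook)
  ...   | inner p<2n = inj₂ (inj₁ (lower , m+n≤o⇒m≤o∸n (large p) upper))
    where
    open ≤-Reasoning
    lower : n + 1 + k ≤ large p
    lower = begin
      n + 1 + k       ≡⟨ solve (n ∷ k ∷ []) ⟩
      suc (n + k)     ≤⟨ s≤s (m≤m+n (n + k) p) ⟩
      suc (n + k + p) ∎
    upper : large p + 1 ≤ 3 * n + k
    upper = begin
      suc (n + k + p) + 1  ≡⟨ solve (n ∷ k ∷ p ∷ []) ⟩
      n + k + suc (suc p)  ≤⟨ +-monoʳ-≤ (n + k) p<2n ⟩
      n + k + (n + n)      ≡⟨ solve (n ∷ k ∷ []) ⟩
      3 * n + k            ∎

  fromTarget : ∀ x → InTarget (3 * n) k 1 n x → ∃ λ i → x ∈abs system i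
  fromTarget x (inj₁ (1≤x , x≤n)) with label-onto x 1≤x x≤n
  ... | i , refl = i , inj₁ refl
  fromTarget x (inj₂ (inj₂ refl)) =
    subst (λ y → ∃ λ i → y ∈abs system i) large-hook (large-covered (n + n) hook)
  fromTarget x (inj₂ (inj₁ (lower , upper))) with m≤n⇒∃[o]m+o≡n lower
  ... | p , refl = subst (λ y → ∃ λ i → y ∈abs system i) large-p (large-covered p (inner p<2n))
    where
    large-p : suc (n + k + p) ≡ n + 1 + k + p
    large-p = solve (n ∷ k ∷ p ∷ [])
    1≤3n+k : 1 ≤ 3 * n + k
    1≤3n+k = ≤-trans 1≤n (≤-trans (m≤m+n n _) (m≤m+n (3 * n) k))
    p<2n : suc p < n + n
    p<2n = +-cancelˡ-≤ (n + k) _ _ (begin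
      n + k + suc (suc p)     ≡⟨ solve (n ∷ k ∷ p ∷ []) ⟩
      suc (n + 1 + k + p)     ≤⟨ s≤s upper ⟩
      suc (3 * n + k ∸ 1)     ≡⟨ m+[n∸m]≡n 1≤3n+k ⟩
      3 * n + k               ≡⟨ solve (n ∷ k ∷ []) ⟩
      n + k + (n + n)         ∎)
      where open ≤-Reasoning

  isSkolem : IsSkolem3 n k 1 system
  isSkolem = (λ i → block-sum (label i)) , n , 1≤n , disjoint ,
             λ x → mk⇔ (fromTarget x) λ (i , x∈i) → toTarget x i x∈i

  close-labels : ∀ {δ d e} i j → label i ≡ d → label j ≡ e → ∣ d - e ∣ ≡ δ →
                 Close δ (system i) (system j)
  close-labels i j refl refl dist = _ , _ , inj₁ refl , inj₁ refl , dist

  close-positions : ∀ {δ p q} i j → IsPosition n first (label i) p → IsPosition n first (label j) q →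
                    ∣ p - q ∣ ≡ δ → Close δ (system i) (system j)
  close-positions {p = p} {q} i j pos pos′ dist =
    _ , _ , large∈block pos , large∈block pos′ , trans (∣m+n-m+o∣≡∣n-o∣ (n + k) p q) dist

  hook∈system : ∀ i → label i ≡ n → first n ≡ n → (3 * n + k + 1) ∈abs system i
  hook∈system i label≡n first-n≡n = subst₂ _∈abs_ large-hook (cong block (sym label≡n))
                                             (large∈block (inj₂ (cong (_+ n) first-n≡n)))

  adjacent⇒close : ∀ {d e} i j → label i ≡ d → label j ≡ e → Adjacent n first d e →
                   Close 1 (system i) (system j)
  adjacent⇒close i j refl refl (_ , _ , pos , pos′ , dist) = close-positions i j pos pos′ dist

-- Transposing two labels

transpose : ℕ → ℕ → ℕ → ℕ
transpose a b x with x ≟ a | x ≟ b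
... | yes _ | _     = b
... | no _  | yes _ = a
... | no _  | no _  = x

transpose-left : ∀ a b → transpose a b a ≡ b
transpose-left a b with a ≟ a
... | yes _   = refl
... | no a≢a  = ⊥-elim (a≢a refl)

transpose-right : ∀ {a b} → b ≢ a → transpose a b b ≡ a
transpose-right {a} {b} b≢a with b ≟ a | b ≟ b
... | yes b≡a | _       = ⊥-elim (b≢a b≡a)
... | no _    | yes _   = refl
... | no _    | no b≢b  = ⊥-elim (b≢b refl)

transpose-other : ∀ {a b x} → x ≢ a → x ≢ b → transpose a b x ≡ x
transpose-other {a} {b} {x} x≢a x≢b with x ≟ a | x ≟ b
... | yes x≡a | _       = ⊥-elim (x≢a x≡a)
... | no _    | yes x≡b = ⊥-elim (x≢b x≡b)
... | no _    | no _    = refl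

transpose-involutive : ∀ a b x → transpose a b (transpose a b x) ≡ x
transpose-involutive a b x with a ≟ x | b ≟ x
... | yes refl | yes refl = trans (cong (transpose a a) (transpose-left a a)) (transpose-left a a)
... | yes refl | no b≢a   = trans (cong (transpose a b) (transpose-left a b)) (transpose-right b≢a)
... | no a≢x   | yes refl = trans (cong (transpose a b) (transpose-right (≢-sym a≢x))) (transpose-left a b)
... | no a≢x   | no b≢x   = trans (cong (transpose a b) τx≡x) τx≡x
  where
  τx≡x : transpose a b x ≡ x
  τx≡x = transpose-other (≢-sym a≢x) (≢-sym b≢x)

transpose-injective : ∀ a b {x y} → transpose a b x ≡ transpose a b y → x ≡ y
transpose-injective a b {x} {y} e = begin
  x                                 ≡⟨ transpose-involutive a b x ⟨
  transpose a b (transpose a b x)   ≡⟨ cong (transpose a b) e ⟩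
  transpose a b (transpose a b y)   ≡⟨ transpose-involutive a b y ⟩
  y                                 ∎
  where open ≡-Reasoning

transpose-preserves : ∀ (P : ℕ → Set) a b x → P a → P b → P x → P (transpose a b x)
transpose-preserves P a b x pa pb px with x ≟ a | x ≟ b
... | yes _ | _     = pb
... | no _  | yes _ = pa
... | no _  | no _  = px

transposed : ∀ {n a b} → 1 ≤ a → a ≤ n → 1 ≤ b → b ≤ n → Labelling n
transposed {n} {a} {b} 1≤a a≤n 1≤b b≤n = record
  { label           = label
  ; label-injective = λ e → toℕ-injective (suc-injective (transpose-injective a b e))
  ; 1≤label         = λ i → proj₁ (in-range (suc (toℕ i)) (s≤s z≤n) (toℕ<n i))
  ; label≤n         = λ i → proj₂ (in-range (suc (toℕ i)) (s≤s z≤n) (toℕ<n i))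
  ; label-onto      = onto
  }
  where
  InRange : ℕ → Set
  InRange d = 1 ≤ d × d ≤ n

  label : Fin n → ℕ
  label i = transpose a b (suc (toℕ i))

  in-range : ∀ d → 1 ≤ d → d ≤ n → InRange (transpose a b d)
  in-range d 1≤d d≤n = transpose-preserves InRange a b d (1≤a , a≤n) (1≤b , b≤n) (1≤d , d≤n)

  onto : ∀ d → 1 ≤ d → d ≤ n → ∃ λ i → label i ≡ d
  onto d 1≤d d≤n = fromℕ< e∸1<n , (begin
    transpose a b (suc (toℕ (fromℕ< e∸1<n))) ≡⟨ cong (λ z → transpose a b (suc z)) (toℕ-fromℕ< e∸1<n) ⟩
    transpose a b (suc (e ∸ 1))              ≡⟨ cong (transpose a b) 1+[e∸1]≡e ⟩
    transpose a b e                          ≡⟨ transpose-involutive a b d ⟩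
    d                                        ∎)
    where
    open ≡-Reasoning
    e = transpose a b d
    1+[e∸1]≡e : suc (e ∸ 1) ≡ e
    1+[e∸1]≡e = m+[n∸m]≡n (proj₁ (in-range d 1≤d d≤n))
    e∸1<n : e ∸ 1 < n
    e∸1<n = subst (_≤ n) (sym 1+[e∸1]≡e) (proj₂ (in-range d 1≤d d≤n))

-- The order 1, …, c, c + 2, c + 1, c + 3, …, n: only the steps c → c + 2 and c + 1 → c + 3 are not between
-- consecutive labels, and the labels c, c + 2 at the odd place c are at distance 2.
module TransposedOrder {n first owner} (hooked : IsHookedSkolem n first owner)
                       (k c : ℕ) (3+c≤n : 3 + c ≤ n) where

  τ : ℕ → ℕ
  τ = transpose (1 + c) (2 + c)

  2+c≤n : 2 + c ≤ n
  2+c≤n = ≤-trans (n≤1+n _) 3+c≤n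

  open SkolemSystem hooked (transposed (s≤s z≤n) (≤-trans (n≤1+n _) 2+c≤n) (s≤s z≤n) 2+c≤n) k public

  n≢2+n : ∀ x → x ≢ 2 + x
  n≢2+n x = <⇒≢ (≤-trans (n<1+n x) (n≤1+n _))

  label-next : ∀ {i j : Fin n} → toℕ j ≡ suc (toℕ i) → label j ≡ τ (2 + toℕ i)
  label-next j≡1+i = cong (λ z → τ (suc z)) j≡1+i

  consecutive : Adjacent n first c (2 + c) → Adjacent n first (1 + c) (3 + c) →
                ∀ i j → toℕ j ≡ suc (toℕ i) → Close 1 (system i) (system j)
  consecutive adj adj′ i j j≡1+i with 1 + c ≟ suc (toℕ i)
  ... | yes 1+c≡x = close-labels i j li lj (∣1+n-n∣≡1 (1 + c))
    where
    li : label i ≡ 2 + c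
    li = trans (cong τ (sym 1+c≡x)) (transpose-left (1 + c) (2 + c))
    lj : label j ≡ 1 + c
    lj = trans (label-next j≡1+i) (trans (cong (τ ∘ suc) (sym 1+c≡x)) (transpose-right {1 + c} 1+n≢n))
  ... | no 1+c≢x with 1 + c ≟ suc (suc (toℕ i))
  ...   | yes 1+c≡1+x = adjacent⇒close i j li lj adj
    where
    x≡c : suc (toℕ i) ≡ c
    x≡c = suc-injective (sym 1+c≡1+x)
    li : label i ≡ c
    li = trans (cong τ x≡c) (transpose-other (≢-sym 1+n≢n) (n≢2+n c))
    lj : label j ≡ 2 + c
    lj = trans (label-next j≡1+i) (trans (cong τ (sym 1+c≡1+x)) (transpose-left (1 + c) (2 + c)))
  ...   | no 1+c≢1+x with 2 + c ≟ suc (toℕ i)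
  ...     | yes 2+c≡x = adjacent⇒close i j li lj adj′
    where
    li : label i ≡ 1 + c
    li = trans (cong τ (sym 2+c≡x)) (transpose-right {1 + c} 1+n≢n)
    lj : label j ≡ 3 + c
    lj = trans (label-next j≡1+i) (trans (cong (τ ∘ suc) (sym 2+c≡x))
           (transpose-other (≢-sym (n≢2+n (1 + c))) 1+n≢n))
  ...     | no 2+c≢x = close-labels i j li lj (∣n-k+n∣≡k 1 (suc (toℕ i)))
    where
    li : label i ≡ suc (toℕ i)
    li = transpose-other (≢-sym 1+c≢x) (≢-sym 2+c≢x)
    lj : label j ≡ suc (suc (toℕ i))
    lj = trans (label-next j≡1+i) (transpose-other (≢-sym 1+c≢1+x) (1+c≢x ∘ suc-injective ∘ sym))

  last : Fin n
  last = fromℕ< {n ∸ 1} (≤-reflexive (m+[n∸m]≡n 1≤n))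

  label-last : label last ≡ n
  label-last = trans (cong (λ z → τ (suc z)) (toℕ-fromℕ< {n ∸ 1} _))
                     (trans (cong τ (m+[n∸m]≡n 1≤n)) (transpose-other n≢1+c n≢2+c))
    where
    n≢1+c : n ≢ 1 + c
    n≢1+c = ≢-sym (<⇒≢ 2+c≤n)
    n≢2+c : n ≢ 2 + c
    n≢2+c = ≢-sym (<⇒≢ 3+c≤n)

  suc-last : suc (toℕ last) ≡ n
  suc-last = trans (cong suc (toℕ-fromℕ< {n ∸ 1} _)) (m+[n∸m]≡n 1≤n)

  distance-two : ∀ h → c ≡ suc (h + h) →
                 ∃ λ i → ∃ λ j → toℕ j ≡ suc (toℕ i) × Even (toℕ i) × Close 2 (system i) (system j)
  distance-two h c≡1+2h = i , j , toℕ-j , (h , toℕ-fromℕ< h+h<n) ,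
    close-labels i j li lj (∣n-k+n∣≡k 2 c)
    where
    c<n : c < n
    c<n = ≤-trans (n≤1+n _) 2+c≤n
    h+h<n : h + h < n
    h+h<n = ≤-trans (≤-reflexive (sym c≡1+2h)) (<⇒≤ c<n)
    i j : Fin n
    i = fromℕ< h+h<n
    j = fromℕ< c<n
    toℕ-j : toℕ j ≡ suc (toℕ i)
    toℕ-j = trans (toℕ-fromℕ< c<n) (trans c≡1+2h (cong suc (sym (toℕ-fromℕ< h+h<n))))
    li : label i ≡ c
    li = trans (cong (λ z → τ (suc z)) (toℕ-fromℕ< h+h<n))
               (trans (cong τ (sym c≡1+2h)) (transpose-other (≢-sym 1+n≢n) (n≢2+n c)))
    lj : label j ≡ 2 + c
    lj = trans (cong (λ z → τ (suc z)) (toℕ-fromℕ< c<n)) (transpose-left (1 + c) (2 + c))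

  isR'Order : Adjacent n first c (2 + c) → Adjacent n first (1 + c) (3 + c) → first n ≡ n →
              ∀ h → c ≡ suc (h + h) → IsR'Order n k 1 system
  isR'Order adj adj′ first-n≡n h c≡1+2h =
    (consecutive adj adj′ , last , suc-last , hook∈system last label-last first-n≡n) , distance-two h c≡1+2h

first₂ : ℕ → ℕ
first₂ 2 = 2
first₂ _ = 0

owner₂ : ℕ → ℕ
owner₂ 0 = 1
owner₂ 1 = 1
owner₂ _ = 2

hooked₂ : IsHookedSkolem 2 first₂ owner₂
hooked₂ = record { placed = placed ; covered = covered }
  where
  placed : ∀ d → 1 ≤ d → d ≤ 2 → Placed 2 first₂ owner₂ d
  placed 1 _ _ = (inner (s≤s (s≤s z≤n)) , refl) , (inner (s≤s (s≤s (s≤s z≤n))) , refl)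
  placed 2 _ _ = (inner ≤-refl , refl) , (hook , refl)
  placed (suc (suc (suc _))) _ (s≤s (s≤s ()))

  covered : ∀ p → Slot 2 p → Covered 2 first₂ p
  covered 0 _ = 1 , ≤-refl , s≤s z≤n , inj₁ refl
  covered 1 _ = 1 , ≤-refl , s≤s z≤n , inj₂ refl
  covered 2 _ = 2 , s≤s z≤n , ≤-refl , inj₁ refl
  covered 4 _ = 2 , s≤s z≤n , ≤-refl , inj₂ refl
  covered 3 (inner (s≤s (s≤s (s≤s (s≤s ())))))
  covered (suc (suc (suc (suc (suc _))))) (inner (s≤s (s≤s (s≤s (s≤s ())))))

r'Ordered₂ : ∀ k → R'OrderedSkolem 2 k
r'Ordered₂ k = system , isSkolem ,
  (consecutive , 1F , refl , hook∈system 1F refl refl) ,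
  (0F , 1F , refl , (0 , refl) , close-positions 0F 1F (inj₁ refl) (inj₁ refl) refl)
  where
  -- transposing 1 with itself: the natural order
  open SkolemSystem hooked₂ (transposed {2} {1} {1} ≤-refl (s≤s z≤n) ≤-refl (s≤s z≤n)) k
  consecutive : ∀ i j → toℕ j ≡ suc (toℕ i) → Close 1 (system i) (system j)
  consecutive 0F 1F _ = close-labels 0F 1F refl refl refl
  consecutive 0F 0F ()
  consecutive 1F 0F ()
  consecutive 1F 1F ()

-- Piecewise functions

Piece : Set
Piece = ℕ × (ℕ → ℕ)

piecewise : ℕ → List Piece → (ℕ → ℕ) → ℕ → ℕ
piecewise b []            f p = f p
piecewise b ((w , g) ∷ L) f p with p <? b + w
... | yes _ = g p
... | no  _ = piecewise (b + w) L f p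

data Loc (p : ℕ) : ℕ → List Piece → Set where
  here   : ∀ {b w g L} u → p ≡ b + u → u < w → Loc p b ((w , g) ∷ L)
  there  : ∀ {b w g L} → Loc p (b + w) L → Loc p b ((w , g) ∷ L)
  beyond : ∀ {b} → b ≤ p → Loc p b []

pattern at₀ u e lt = here u e lt
pattern at₁ u e lt = there (at₀ u e lt)
pattern at₂ u e lt = there (at₁ u e lt)
pattern at₃ u e lt = there (at₂ u e lt)
pattern at₄ u e lt = there (at₃ u e lt)
pattern at₅ u e lt = there (at₄ u e lt)
pattern at₆ u e lt = there (at₅ u e lt)
pattern at₇ u e lt = there (at₆ u e lt)
pattern at₈ u e lt = there (at₇ u e lt)
pattern at₉ u e lt = there (at₈ u e lt)
pattern at₁₀ u e lt = there (at₉ u e lt)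
pattern at₁₁ u e lt = there (at₁₀ u e lt)
pattern beyond₁ h = there (beyond h)
pattern beyond₄ h = there (there (there (there (beyond h))))
pattern beyond₁₂ h = there (there (there (there (there (there (there (there (there (there (there (there (beyond h))))))))))))

valueAt : ∀ {p b L} → Loc p b L → (ℕ → ℕ) → ℕ
valueAt {p} (here {g = g} _ _ _) f = g p
valueAt     (there l)            f = valueAt l f
valueAt {p} (beyond _)           f = f p

Loc-base : ∀ {p b L} → Loc p b L → b ≤ p
Loc-base {b = b} (here u refl _)      = m≤m+n b u
Loc-base {b = b} (there {w = w} l)    = ≤-trans (m≤m+n b w) (Loc-base l)
Loc-base         (beyond b≤p)         = b≤p

piecewise-at : ∀ {p b L} f (l : Loc p b L) → piecewise b L f p ≡ valueAt l f
piecewise-at {b = b} f (here {w = w} u refl u<w) with b + u <? b + w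
... | yes _    = refl
... | no  b+u≮ = ⊥-elim (b+u≮ (+-monoʳ-< b u<w))
piecewise-at {p} {b} f (there {w = w} l) with p <? b + w
... | yes p<b+w = ⊥-elim (<⇒≱ p<b+w (Loc-base l))
... | no  _     = piecewise-at f l
piecewise-at f (beyond _) = refl

locate : ∀ b L p → b ≤ p → Loc p b L
locate b []            p b≤p = beyond b≤p
locate b ((w , g) ∷ L) p b≤p with p <? b + w
... | yes p<b+w = here (p ∸ b) (sym (m+[n∸m]≡n b≤p))
                       (+-cancelˡ-< b _ _ (subst (_< b + w) (sym (m+[n∸m]≡n b≤p)) p<b+w))
... | no  p≮b+w = there (locate (b + w) L p (≮⇒≥ p≮b+w))

-- A hooked Skolem sequence of order 4t + 6

half : ℕ → ℕ ⊎ ℕ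
half zero    = inj₁ 0
half (suc d) = [ inj₂ , inj₁ ∘ suc ]′ (half d)

half-even : ∀ q → half (q + q) ≡ inj₁ q
half-even zero    = refl
half-even (suc q) rewrite +-suc q q | half-even q = refl

half-odd : ∀ q → half (suc (q + q)) ≡ inj₂ q
half-odd q rewrite half-even q = refl

data Parity : ℕ → Set where
  even : ∀ q → Parity (q + q)
  odd  : ∀ q → Parity (suc (q + q))

parity : ∀ d → Parity d
parity zero = even 0
parity (suc d) with parity d
... | even q = odd q
... | odd q  = subst Parity (cong suc (+-suc q q)) (even (suc q))

-- Label 2q (1 ≤ q ≤ 2t + 2) sits at 2t + 2 ∓ q and label 1 at 7t + 9, 7t + 10. Label 2q + 1 sits at
-- 6t + 7 − q, 6t + 8 + q for 1 ≤ q ≤ t; at 4t + 5, 6t + 8 for q = t + 1; at 6t + 8 − q, 6t + 9 + q for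
-- t + 2 ≤ q ≤ 2t + 1; and at 2t + 2, 6t + 7 for q = 2t + 2. Label 4t + 6 sits at 4t + 6 and the hook 8t + 12.
-- The tables list the first positions of even and odd labels (by q) and the owner of each position.
evenTable : ℕ → List Piece
evenTable t = (2 * t + 3 , λ q → 2 * t + 2 ∸ q) ∷ []

oddTable : ℕ → List Piece
oddTable t =
  (1 , λ _ → 7 * t + 9) ∷
  (t , λ q → 6 * t + 7 ∸ q) ∷
  (1 , λ _ → 4 * t + 5) ∷
  (t , λ q → 6 * t + 8 ∸ q) ∷ []

ownerTable : ℕ → List Piece
ownerTable t =
  (2 * t + 2 , λ p → 4 * t + 4 ∸ (p + p)) ∷
  (1         , λ _ → 4 * t + 5) ∷
  (2 * t + 2 , λ p → p + p ∸ (4 * t + 4)) ∷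
  (1         , λ _ → 2 * t + 3) ∷
  (1         , λ _ → 4 * t + 6) ∷
  (t         , λ p → 12 * t + 17 ∸ (p + p)) ∷
  (t         , λ p → 12 * t + 15 ∸ (p + p)) ∷
  (1         , λ _ → 4 * t + 5) ∷
  (1         , λ _ → 2 * t + 3) ∷
  (t         , λ p → p + p ∸ (12 * t + 15)) ∷
  (2         , λ _ → 1) ∷
  (t         , λ p → p + p ∸ (12 * t + 17)) ∷ []

-- Opaque, so that first t d and owner t p stay rigid for unification; only the lemmas below look inside.
opaque
  first : ℕ → ℕ → ℕ
  first t d = [ piecewise 0 (evenTable t) (λ _ → 4 * t + 6)
              , piecewise 0 (oddTable t) (λ _ → 2 * t + 2) ]′ (half d)

  owner : ℕ → ℕ → ℕ
  owner t = piecewise 0 (ownerTable t) (λ _ → 4 * t + 6)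

  first-evenAt : ∀ t d q {y} → d ≡ q + q → (l : Loc q 0 (evenTable t)) →
                 valueAt l (λ _ → 4 * t + 6) ≡ y → first t d ≡ y
  first-evenAt t d q refl l e = trans (cong [ _ , _ ]′ (half-even q)) (trans (piecewise-at _ l) e)

  first-oddAt : ∀ t d q {y} → d ≡ suc (q + q) → (l : Loc q 0 (oddTable t)) →
                valueAt l (λ _ → 2 * t + 2) ≡ y → first t d ≡ y
  first-oddAt t d q refl l e = trans (cong [ _ , _ ]′ (half-odd q)) (trans (piecewise-at _ l) e)

  ownerAt : ∀ t p {y} (l : Loc p 0 (ownerTable t)) → valueAt l (λ _ → 4 * t + 6) ≡ y → owner t p ≡ y
  ownerAt t p l e = trans (piecewise-at _ l) e

Placedᵗ : ℕ → ℕ → Set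
Placedᵗ t = Placed (4 * t + 6) (first t) (owner t)

Coveredᵗ : ℕ → ℕ → Set
Coveredᵗ t = Covered (4 * t + 6) (first t)

first-even : ∀ {t} q y → q + y ≡ 2 * t + 2 → first t (q + q) ≡ y
first-even {t} q y e = first-evenAt t (q + q) q refl
  (at₀ q refl (m+n≡o⇒m≤o y (trans (cong suc e) (sym (+-suc _ 2))))) (m+n≡o⇒o∸m≡n q (2 * t + 2) e)

first-hook : ∀ t → first t (4 * t + 6) ≡ 4 * t + 6
first-hook t = first-evenAt t (4 * t + 6) (2 * t + 3) (solve (t ∷ [])) (beyond₁ ≤-refl) refl

first-one : ∀ t → first t 1 ≡ 7 * t + 9
first-one t = first-oddAt t 1 0 refl (at₀ 0 refl (s≤s z≤n)) refl

first-low : ∀ {t} x y → suc x + y ≡ t → first t (2 * x + 3) ≡ 5 * t + 7 + y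
first-low {t} x y e = first-oddAt t (2 * x + 3) (suc x) (solve (x ∷ []))
  (at₁ x refl (m+n≡o⇒m≤o y e))
  (m+n≡o⇒o∸m≡n (suc x) (6 * t + 7) (≡-via (λ s → s + 5 * t + 7) e (solve (t ∷ x ∷ y ∷ [])) (solve (t ∷ []))))

first-mid : ∀ t → first t (2 * t + 3) ≡ 4 * t + 5
first-mid t = first-oddAt t (2 * t + 3) (suc t) (solve (t ∷ [])) (at₂ 0 (solve (t ∷ [])) (s≤s z≤n)) refl

first-high : ∀ {t} w y → suc w + y ≡ t → first t (2 * t + 5 + 2 * w) ≡ 4 * t + 7 + y
first-high {t} w y e = first-oddAt t (2 * t + 5 + 2 * w) (t + 2 + w) (solve (t ∷ w ∷ []))
  (at₃ w (solve (t ∷ w ∷ [])) (m+n≡o⇒m≤o y e))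
  (m+n≡o⇒o∸m≡n (t + 2 + w) (6 * t + 8) (≡-via (λ s → s + 5 * t + 8) e (solve (t ∷ w ∷ y ∷ [])) (solve (t ∷ []))))

first-top : ∀ t → first t (4 * t + 5) ≡ 2 * t + 2
first-top t = first-oddAt t (4 * t + 5) (2 * t + 2) (solve (t ∷ [])) (beyond₄ (m+n≡o⇒m≤o 0 (solve (t ∷ [])))) refl

placed-at : ∀ {t d} a → first t d ≡ a → Slot (4 * t + 6) a → Slot (4 * t + 6) (a + d) →
          owner t a ≡ d → owner t (a + d) ≡ d → Placedᵗ t d
placed-at a refl slot slot′ own own′ = (slot , own) , (slot′ , own′)

placed-even : ∀ {t} q y → 1 ≤ q → q + y ≡ 2 * t + 2 → Placedᵗ t (q + q)
placed-even {t} (suc u) y _ e = placed-at {t} y (first-even {t} (suc u) y e)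
  (inner (m+n≡o⇒m≤o (6 * t + 8 + suc u)
    (≡-via (λ s → s + 6 * t + 10) e (solve (t ∷ u ∷ y ∷ [])) (solve (t ∷ [])))))
  (inner (m+n≡o⇒m≤o (4 * t + 6 + y)
    (≡-via (λ s → s + s + 4 * t + 8) e (solve (t ∷ u ∷ y ∷ [])) (solve (t ∷ [])))))
  (ownerAt t y (at₀ y refl (m+n≡o⇒m≤o u (trans (cong suc (+-comm y u)) e)))
    (m+n≡o⇒o∸m≡n (y + y) (4 * t + 4)
      (≡-via (λ s → s + s) e (solve (u ∷ y ∷ [])) (solve (t ∷ [])))))
  (ownerAt t (y + (suc u + suc u))
    (at₂ u (≡-via (λ s → s + suc u) e (solve (u ∷ y ∷ [])) (solve (t ∷ u ∷ []))) (m+n≡o⇒m≤o y e))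
    (m+n≡o⇒o∸m≡n (4 * t + 4) _
      (≡-via (λ s → s + s + (suc u + suc u)) (sym e) (solve (t ∷ u ∷ [])) (solve (u ∷ y ∷ [])))))

placed-hook : ∀ t → Placedᵗ t (4 * t + 6)
placed-hook t = placed-at {t} (4 * t + 6) (first-hook t)
  (inner (m+n≡o⇒m≤o (4 * t + 4) (solve (t ∷ []))))
  hook
  (ownerAt t (4 * t + 6) (at₄ 0 (solve (t ∷ [])) (s≤s z≤n)) refl)
  (ownerAt t (4 * t + 6 + (4 * t + 6)) (beyond₁₂ (m+n≡o⇒m≤o 1 (solve (t ∷ [])))) refl)

placed-one : ∀ t → Placedᵗ t 1
placed-one t = placed-at {t} (7 * t + 9) (first-one t)
  (inner (m+n≡o⇒m≤o (t + 1) (solve (t ∷ []))))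
  (inner (m+n≡o⇒m≤o t (solve (t ∷ []))))
  (ownerAt t (7 * t + 9) (at₁₀ 0 (solve (t ∷ [])) (s≤s z≤n)) refl)
  (ownerAt t (7 * t + 9 + 1) (at₁₀ 1 (solve (t ∷ [])) (s≤s (s≤s z≤n))) refl)

placed-low : ∀ {t} x y → suc x + y ≡ t → Placedᵗ t (2 * x + 3)
placed-low {t} x y e = placed-at {t} (5 * t + 7 + y) (first-low {t} x y e)
  (inner (m+n≡o⇒m≤o (2 * t + 4 + x)
    (≡-via (λ s → s + 7 * t + 12) e (solve (t ∷ x ∷ y ∷ [])) (solve (t ∷ [])))))
  (inner (m+n≡o⇒m≤o (x + 2 * y + 3)
    (≡-via (λ s → s + s + s + 5 * t + 12) e (solve (t ∷ x ∷ y ∷ [])) (solve (t ∷ [])))))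
  (ownerAt t (5 * t + 7 + y) (at₆ y (solve (t ∷ y ∷ [])) (m+n≡o⇒m≤o x (trans (cong suc (+-comm y x)) e)))
    (m+n≡o⇒o∸m≡n (5 * t + 7 + y + (5 * t + 7 + y)) (12 * t + 15)
      (≡-via (λ s → s + s + 10 * t + 15) e (solve (t ∷ x ∷ y ∷ [])) (solve (t ∷ [])))))
  (ownerAt t (5 * t + 7 + y + (2 * x + 3))
    (at₉ x (≡-via (λ s → s + 5 * t + 9 + x) e (solve (t ∷ x ∷ y ∷ [])) (solve (t ∷ x ∷ []))) (m+n≡o⇒m≤o y e))
    (m+n≡o⇒o∸m≡n (12 * t + 15) _
      (≡-via (λ s → s + s + 10 * t + 18 + 2 * x) (sym e) (solve (t ∷ x ∷ [])) (solve (t ∷ x ∷ y ∷ [])))))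

placed-mid : ∀ t → Placedᵗ t (2 * t + 3)
placed-mid t = placed-at {t} (4 * t + 5) (first-mid t)
  (inner (m+n≡o⇒m≤o (4 * t + 5) (solve (t ∷ []))))
  (inner (m+n≡o⇒m≤o (2 * t + 2) (solve (t ∷ []))))
  (ownerAt t (4 * t + 5) (at₃ 0 (solve (t ∷ [])) (s≤s z≤n)) refl)
  (ownerAt t (4 * t + 5 + (2 * t + 3)) (at₈ 0 (solve (t ∷ [])) (s≤s z≤n)) refl)

placed-high : ∀ {t} w y → suc w + y ≡ t → Placedᵗ t (2 * t + 5 + 2 * w)
placed-high {t} w y e = placed-at {t} (4 * t + 7 + y) (first-high {t} w y e)
  (inner (m+n≡o⇒m≤o (3 * t + 4 + w)
    (≡-via (λ s → s + 7 * t + 12) e (solve (t ∷ w ∷ y ∷ [])) (solve (t ∷ [])))))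
  (inner (m+n≡o⇒m≤o y
    (≡-via (λ s → s + s + 6 * t + 12) e (solve (t ∷ w ∷ y ∷ [])) (solve (t ∷ [])))))
  (ownerAt t (4 * t + 7 + y) (at₅ y (solve (t ∷ y ∷ [])) (m+n≡o⇒m≤o w (trans (cong suc (+-comm y w)) e)))
    (m+n≡o⇒o∸m≡n (4 * t + 7 + y + (4 * t + 7 + y)) (12 * t + 17)
      (≡-via (λ s → s + s + 10 * t + 17) e (solve (t ∷ w ∷ y ∷ [])) (solve (t ∷ [])))))
  (ownerAt t (4 * t + 7 + y + (2 * t + 5 + 2 * w))
    (at₁₁ w (≡-via (λ s → s + 6 * t + 11 + w) e (solve (t ∷ w ∷ y ∷ [])) (solve (t ∷ w ∷ []))) (m+n≡o⇒m≤o y e))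
    (m+n≡o⇒o∸m≡n (12 * t + 17) _
      (≡-via (λ s → s + s + 12 * t + 22 + 2 * w) (sym e) (solve (t ∷ w ∷ [])) (solve (t ∷ w ∷ y ∷ [])))))

placed-top : ∀ t → Placedᵗ t (4 * t + 5)
placed-top t = placed-at {t} (2 * t + 2) (first-top t)
  (inner (m+n≡o⇒m≤o (6 * t + 8) (solve (t ∷ []))))
  (inner (m+n≡o⇒m≤o (2 * t + 3) (solve (t ∷ []))))
  (ownerAt t (2 * t + 2) (at₁ 0 (solve (t ∷ [])) (s≤s z≤n)) refl)
  (ownerAt t (2 * t + 2 + (4 * t + 5)) (at₇ 0 (solve (t ∷ [])) (s≤s z≤n)) refl)

placed : ∀ t d → 1 ≤ d → d ≤ 4 * t + 6 → Placedᵗ t d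
placed t d 1≤d d≤n with parity d
placed t _ () _ | even zero
placed t _ 1≤d d≤n | even (suc q) with locate 0 (evenTable t) (suc q) z≤n
... | at₀ _ refl q<2t+3 with m≤n⇒∃[o]m+o≡n q<2t+3
...   | y , e = placed-even (suc q) y (s≤s z≤n) (suc-injective (trans e (+-suc (2 * t) 2)))
placed t _ 1≤d d≤n | even (suc q) | beyond₁ 2t+3≤q =
  cast (Placedᵗ t) (placed-hook t) (trans (cong (λ z → z + z) q≡2t+3) (solve (t ∷ [])))
  where
  q≡2t+3 : suc q ≡ 2 * t + 3
  q≡2t+3 = ≤-antisym (double-≤⇒≤ (≤-trans d≤n (≤-reflexive (solve (t ∷ []))))) 2t+3≤q
placed t _ 1≤d d≤n | odd q with locate 0 (oddTable t) q z≤n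
... | at₀ zero refl _ = placed-one t
... | at₀ (suc _) _ (s≤s ())
... | at₁ u e u<t with m≤n⇒∃[o]m+o≡n u<t
...   | y , e′ = cast (Placedᵗ t) (placed-low {t} u y e′) (trans (cong (λ z → suc (z + z)) e) (solve (u ∷ [])))
placed t _ 1≤d d≤n | odd q | at₂ zero e _ =
  cast (Placedᵗ t) (placed-mid t) (trans (cong (λ z → suc (z + z)) e) (solve (t ∷ [])))
placed t _ 1≤d d≤n | odd q | at₂ (suc _) _ (s≤s ())
placed t _ 1≤d d≤n | odd q | at₃ w e w<t with m≤n⇒∃[o]m+o≡n w<t
... | y , e′ = cast (Placedᵗ t) (placed-high {t} w y e′) (trans (cong (λ z → suc (z + z)) e) (solve (t ∷ w ∷ [])))
placed t _ 1≤d d≤n | odd q | beyond₄ 2t+2≤q =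
  cast (Placedᵗ t) (placed-top t) (trans (cong (λ z → suc (z + z)) q≡2t+2) (solve (t ∷ [])))
  where
  q≡2t+2 : q ≡ 2 * t + 2
  q≡2t+2 = ≤-antisym (≤-pred (double-<⇒< {q} {suc (2 * t + 2)} (≤-trans d≤n (≤-reflexive (solve (t ∷ []))))))
                     (subst (_≤ q) base 2t+2≤q)
    where
    base : 0 + 1 + t + 1 + t ≡ 2 * t + 2
    base = solve (t ∷ [])

covered-even₁ : ∀ t u → u < 2 * t + 2 → Coveredᵗ t u
covered-even₁ t u u< with m≤n⇒∃[o]m+o≡n u<
... | o , e = suc o + suc o , s≤s z≤n ,
  m+n≡o⇒m≤o (u + u + 2) (≡-via (λ s → s + s + 2) e′ (solve (o ∷ u ∷ [])) (solve (t ∷ []))) ,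
  inj₁ (first-even (suc o) u e′)
  where
  e′ : suc o + u ≡ 2 * t + 2
  e′ = trans (cong suc (+-comm o u)) e

covered-even₂ : ∀ t u → u < 2 * t + 2 → Coveredᵗ t (2 * t + 3 + u)
covered-even₂ t u u< with m≤n⇒∃[o]m+o≡n u<
... | y , e = suc u + suc u , s≤s z≤n ,
  m+n≡o⇒m≤o (y + y + 2) (≡-via (λ s → s + s + 2) e (solve (u ∷ y ∷ [])) (solve (t ∷ []))) ,
  inj₂ (trans (cong (_+ (suc u + suc u)) (first-even (suc u) y e))
              (≡-via (λ s → s + suc u) e (solve (u ∷ y ∷ [])) (solve (t ∷ u ∷ []))))

covered-high₁ : ∀ t u → u < t → Coveredᵗ t (4 * t + 7 + u)
covered-high₁ t u u<t with m≤n⇒∃[o]m+o≡n u<t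
... | v , e = 2 * t + 5 + 2 * v , m+n≡o⇒m≤o (2 * t + 4 + 2 * v) (solve (t ∷ v ∷ [])) ,
  m+n≡o⇒m≤o (2 * u + 3) (≡-via (λ s → s + s + 2 * t + 6) e (solve (t ∷ u ∷ v ∷ [])) (solve (t ∷ []))) ,
  inj₁ (first-high v u (trans (cong suc (+-comm v u)) e))

covered-low₁ : ∀ t u → u < t → Coveredᵗ t (5 * t + 7 + u)
covered-low₁ t u u<t with m≤n⇒∃[o]m+o≡n u<t
... | v , e = 2 * v + 3 , m+n≡o⇒m≤o (2 * v + 2) (solve (v ∷ [])) ,
  m+n≡o⇒m≤o (4 * u + 2 * v + 7) (≡-via (λ s → s + s + s + s + 6) e (solve (u ∷ v ∷ [])) (solve (t ∷ []))) ,
  inj₁ (first-low v u (trans (cong suc (+-comm v u)) e))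

covered-low₂ : ∀ t u → u < t → Coveredᵗ t (6 * t + 9 + u)
covered-low₂ t u u<t with m≤n⇒∃[o]m+o≡n u<t
... | y , e = 2 * u + 3 , m+n≡o⇒m≤o (2 * u + 2) (solve (u ∷ [])) ,
  m+n≡o⇒m≤o (2 * u + 4 * y + 7) (≡-via (λ s → s + s + s + s + 6) e (solve (u ∷ y ∷ [])) (solve (t ∷ []))) ,
  inj₂ (trans (cong (_+ (2 * u + 3)) (first-low u y e))
              (≡-via (λ s → s + 5 * t + 9 + u) e (solve (t ∷ u ∷ y ∷ [])) (solve (t ∷ u ∷ []))))

covered-high₂ : ∀ t u → u < t → Coveredᵗ t (7 * t + 11 + u)
covered-high₂ t u u<t with m≤n⇒∃[o]m+o≡n u<t
... | y , e = 2 * t + 5 + 2 * u , m+n≡o⇒m≤o (2 * t + 4 + 2 * u) (solve (t ∷ u ∷ [])) ,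
  m+n≡o⇒m≤o (2 * y + 3) (≡-via (λ s → s + s + 2 * t + 6) e (solve (t ∷ u ∷ y ∷ [])) (solve (t ∷ []))) ,
  inj₂ (trans (cong (_+ (2 * t + 5 + 2 * u)) (first-high u y e))
              (≡-via (λ s → s + 6 * t + 11 + u) e (solve (t ∷ u ∷ y ∷ [])) (solve (t ∷ u ∷ []))))

covered-top : ∀ t → Coveredᵗ t (2 * t + 2) × Coveredᵗ t (6 * t + 7)
covered-top t = (_ , 1≤d , d≤n , inj₁ (first-top t)) ,
                (_ , 1≤d , d≤n , inj₂ (trans (cong (_+ (4 * t + 5)) (first-top t)) (solve (t ∷ []))))
  where
  1≤d : 1 ≤ 4 * t + 5
  1≤d = m+n≡o⇒m≤o (4 * t + 4) (solve (t ∷ []))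
  d≤n : 4 * t + 5 ≤ 4 * t + 6
  d≤n = m+n≡o⇒m≤o 1 (solve (t ∷ []))

covered-mid : ∀ t → Coveredᵗ t (4 * t + 5) × Coveredᵗ t (6 * t + 8)
covered-mid t = (_ , 1≤d , d≤n , inj₁ (first-mid t)) ,
                (_ , 1≤d , d≤n , inj₂ (trans (cong (_+ (2 * t + 3)) (first-mid t)) (solve (t ∷ []))))
  where
  1≤d : 1 ≤ 2 * t + 3
  1≤d = m+n≡o⇒m≤o (2 * t + 2) (solve (t ∷ []))
  d≤n : 2 * t + 3 ≤ 4 * t + 6
  d≤n = m+n≡o⇒m≤o (2 * t + 3) (solve (t ∷ []))

covered-hook : ∀ t → Coveredᵗ t (4 * t + 6) × Coveredᵗ t (4 * t + 6 + (4 * t + 6))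
covered-hook t = (_ , 1≤n , ≤-refl , inj₁ (first-hook t)) ,
                 (_ , 1≤n , ≤-refl , inj₂ (cong (_+ (4 * t + 6)) (first-hook t)))
  where
  1≤n : 1 ≤ 4 * t + 6
  1≤n = m+n≡o⇒m≤o (4 * t + 5) (solve (t ∷ []))

covered-one : ∀ t → Coveredᵗ t (7 * t + 9) × Coveredᵗ t (7 * t + 9 + 1)
covered-one t = (1 , ≤-refl , d≤n , inj₁ (first-one t)) , (1 , ≤-refl , d≤n , inj₂ (cong (_+ 1) (first-one t)))
  where
  d≤n : 1 ≤ 4 * t + 6
  d≤n = m+n≡o⇒m≤o (4 * t + 5) (solve (t ∷ []))

covered : ∀ t p → Slot (4 * t + 6) p → Coveredᵗ t p
covered t p slot with locate 0 (ownerTable t) p z≤n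
... | at₀ u refl u< = covered-even₁ t u u<
... | at₁ zero e _ = cast (Coveredᵗ t) (proj₁ (covered-top t)) (trans e (solve (t ∷ [])))
... | at₂ u e u< = cast (Coveredᵗ t) (covered-even₂ t u u<) (trans e (solve (t ∷ u ∷ [])))
... | at₃ zero e _ = cast (Coveredᵗ t) (proj₁ (covered-mid t)) (trans e (solve (t ∷ [])))
... | at₄ zero e _ = cast (Coveredᵗ t) (proj₁ (covered-hook t)) (trans e (solve (t ∷ [])))
... | at₅ u e u< = cast (Coveredᵗ t) (covered-high₁ t u u<) (trans e (solve (t ∷ u ∷ [])))
... | at₆ u e u< = cast (Coveredᵗ t) (covered-low₁ t u u<) (trans e (solve (t ∷ u ∷ [])))
... | at₇ zero e _ = cast (Coveredᵗ t) (proj₂ (covered-top t)) (trans e (solve (t ∷ [])))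
... | at₈ zero e _ = cast (Coveredᵗ t) (proj₂ (covered-mid t)) (trans e (solve (t ∷ [])))
... | at₉ u e u< = cast (Coveredᵗ t) (covered-low₂ t u u<) (trans e (solve (t ∷ u ∷ [])))
... | at₁₀ zero e _ = cast (Coveredᵗ t) (proj₁ (covered-one t)) (trans e (solve (t ∷ [])))
... | at₁₀ (suc zero) e _ = cast (Coveredᵗ t) (proj₂ (covered-one t)) (trans e (solve (t ∷ [])))
... | at₁₁ u e u< = cast (Coveredᵗ t) (covered-high₂ t u u<) (trans e (solve (t ∷ u ∷ [])))
... | at₁ (suc _) _ (s≤s ())
... | at₃ (suc _) _ (s≤s ())
... | at₄ (suc _) _ (s≤s ())
... | at₇ (suc _) _ (s≤s ())
... | at₈ (suc _) _ (s≤s ())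
... | at₁₀ (suc (suc _)) _ (s≤s (s≤s ()))
... | beyond₁₂ end≤p with slot
...   | hook = proj₂ (covered-hook t)
...   | inner p<2n = ⊥-elim (<⇒≱ (≤-trans (s≤s (s≤s end≤p)) p<2n) (m+n≡o⇒m≤o 0 (solve (t ∷ []))))

hooked : ∀ t → IsHookedSkolem (4 * t + 6) (first t) (owner t)
hooked t = record { placed = placed t ; covered = covered t }

adjacent-2-4 : ∀ t → Adjacent (4 * t + 6) (first t) 2 4
adjacent-2-4 t = 2 * t + 1 , 2 * t ,
  inj₁ (first-even {t} 1 (2 * t + 1) (solve (t ∷ []))) , inj₁ (first-even {t} 2 (2 * t) (solve (t ∷ []))) ,
  trans (∣-∣-comm (2 * t + 1) (2 * t)) (∣m-m+n∣≡n (2 * t) 1)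

adjacent-3-5 : ∀ s → Adjacent (4 * (2 + s) + 6) (first (2 + s)) 3 5
adjacent-3-5 s = _ , _ , inj₁ (first-low 0 (suc s) refl) , inj₁ (first-low 1 s refl) ,
  trans (∣m+n-m+o∣≡∣n-o∣ (5 * (2 + s) + 7) (suc s) s) (∣1+n-n∣≡1 s)

adjacent-4-6 : ∀ s → Adjacent (4 * (2 + s) + 6) (first (2 + s)) 4 6
adjacent-4-6 s = 2 * s + 4 , 2 * s + 3 ,
  inj₁ (first-even {2 + s} 2 (2 * s + 4) (solve (s ∷ []))) ,
  inj₁ (first-even {2 + s} 3 (2 * s + 3) (solve (s ∷ []))) ,
  ∣m+n-m+o∣≡∣n-o∣ (2 * s) 4 3

r'Ordered : ∀ k t → R'OrderedSkolem (4 * t + 6) k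
r'Ordered k 0 = system , isSkolem , isR'Order adjacent-1-3 (adjacent-2-4 0) (first-hook 0) 0 refl
  where
  open TransposedOrder (hooked 0) k 1 (s≤s (s≤s (s≤s (s≤s z≤n))))
  adjacent-1-3 : Adjacent 6 (first 0) 1 3
  adjacent-1-3 = 9 , 8 , inj₁ (first-one 0) , inj₂ (cong (_+ 3) (first-mid 0)) , refl
r'Ordered k 1 = system , isSkolem , isR'Order adjacent-1-3 (adjacent-2-4 1) (first-hook 1) 0 refl
  where
  open TransposedOrder (hooked 1) k 1 (s≤s (s≤s (s≤s (s≤s z≤n))))
  adjacent-1-3 : Adjacent 10 (first 1) 1 3
  adjacent-1-3 = 16 , 15 , inj₁ (first-one 1) , inj₂ (cong (_+ 3) (first-low 0 0 refl)) , refl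
r'Ordered k (suc (suc s)) = system , isSkolem ,
  isR'Order (adjacent-3-5 s) (adjacent-4-6 s) (first-hook (2 + s)) 1 refl
  where open TransposedOrder (hooked (2 + s)) k 3 (m≤n+m 6 (4 * (2 + s)))

lemma18 : (k n : ℕ) → 1 ≤ n → n % 4 ≡ 2 →
    Σ (Fin n → Triple) λ D → IsSkolem3 n k 1 D × IsR'Order n k 1 D
lemma18 k n _ n%4≡2 = by-quotient (n / 4) (trans (m≡m%n+[m/n]*n n 4) (cong (_+ n / 4 * 4) n%4≡2))
  where
  by-quotient : ∀ q → n ≡ 2 + q * 4 → R'OrderedSkolem n k
  by-quotient zero    n≡2    = cast (λ m → R'OrderedSkolem m k) (r'Ordered₂ k) n≡2
  by-quotient (suc t) n≡2+4q = cast (λ m → R'OrderedSkolem m k) (r'Ordered k t) (trans n≡2+4q (solve (t ∷ [])))
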